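{- If $R$ is a graph on $s$ vertices, then \[ \phi(R)\le\phi(K_s)=s(2^{s-1}-1). \]
   Context: Graphs are finite and simple. For a graph $R$ and nonempty $I\subseteq V(R)$, $\delta_I=\min\{d_R(x):x\in I\}$, and the fixed loss of $R$ is \[ \phi(R)=\sum_{\substack{I \text{ independent in } R\\ I\neq\emptyset}}\bigl(2^{\delta_I}-1\bigr). \] $K_s$ is the complete graph on $s$ vertices. -}

module Defs where

open import Data.Bool using (Bool; true; false; _∧_; not; if_then_else_)
open import Data.Nat using (ℕ; zero; suc; _+_; _*_; _∸_; _^_; _⊓_)
open import Data.Fin using (Fin)
open import Data.Fin.Subset using (Subset)
open import Data.Vec using (Vec; []; _∷_; lookup)
open import Data.List using (List; []; _∷_; map; filter; foldr; _++_; length; allFin)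
open import Data.Bool.ListAction using (and)
open import Data.Nat.ListAction using (sum)
open import Relation.Binary.PropositionalEquality using (_≡_; refl; sym)
open import Relation.Nullary using (yes; no)
open import Data.Empty using (⊥-elim)
open import Data.Fin using (_≟_)
open import Relation.Nullary.Decidable using (does)

record Graph (s : ℕ) : Set where
  field
    adj    : Fin s → Fin s → Bool
    adj-sym : ∀ x y → adj x y ≡ adj y x
    irrefl : ∀ x → adj x x ≡ false

open Graph public

neq : ∀ {s} → Fin s → Fin s → Bool
neq x y = not (does (x ≟ y))

neq-sym : ∀ {s} (x y : Fin s) → neq x y ≡ neq y x
neq-sym x y with x ≟ y | y ≟ x
... | yes _ | yes _ = refl
... | no _  | no _  = refl
... | yes p | no q  = ⊥-elim (q (sym p))
... | no p  | yes q = ⊥-elim (p (sym q))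

neq-irr : ∀ {s} (x : Fin s) → neq x x ≡ false
neq-irr x with x ≟ x
... | yes _ = refl
... | no p  = ⊥-elim (p refl)

K : (s : ℕ) → Graph s
K s = record { adj = neq ; adj-sym = neq-sym ; irrefl = neq-irr }

degree : ∀ {s} → Graph s → Fin s → ℕ
degree R x = length (filter (λ y → Data.Bool._≟_ (adj R x y) true) (allFin _))
  where import Data.Bool

subsets : (n : ℕ) → List (Subset n)
subsets zero = [] ∷ []
subsets (suc n) = map (false ∷_) (subsets n) ++ map (true ∷_) (subsets n)

members : ∀ {n} → Subset n → List (Fin n)
members {n} I = filter (λ x → Data.Bool._≟_ (lookup I x) true) (allFin n)
  where import Data.Bool

nonempty : ∀ {n} → Subset n → Bool
nonempty I with members I
... | [] = false
... | _ ∷ _ = true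

independent : ∀ {s} → Graph s → Subset s → Bool
independent R I = and (map (λ x → and (map (λ y → not (adj R x y)) (members I))) (members I))

-- δ_I = min degree over members of I (only used for nonempty I)
δ : ∀ {s} → Graph s → Subset s → ℕ
δ R I with map (degree R) (members I)
... | [] = 0
... | d ∷ ds = foldr _⊓_ d ds

φ : ∀ {s} → Graph s → ℕ
φ {s} R = sum (map (λ I → 2 ^ δ R I ∸ 1)
                (filter (λ I → Data.Bool._≟_ (independent R I ∧ nonempty I) true) (subsets s)))
  where import Data.Bool

-- Every vertex x defines the family of vertex sets that contain x and avoid its
-- neighbourhood; it has 2^(s - 1 - d(x)) members. A nonempty independent set I
-- belongs to the family of each of its vertices, and 2^δ_I - 1 is at most the
-- weight 2^d(x) - 1 of a vertex x ∈ I of minimum degree. Summing over x gives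
--   φ(R) ≤ Σ_x (2^d(x) - 1) 2^(s - 1 - d(x)) ≤ s (2^(s-1) - 1).
-- In K_s every such family is the single set {x}, so both inequalities are
-- equalities there.
module Submission where

open import Data.Bool using (Bool; true; false; _∧_; not; if_then_else_)
import Data.Bool as Bool
open import Data.Bool.ListAction using (and)
open import Data.Bool.Properties using (∧-conicalˡ; ∧-conicalʳ; not-injective)
open import Data.Empty using (⊥-elim)
open import Data.Fin using (Fin; zero; suc; _≟_)
open import Data.Fin.Subset using (Subset)
open import Data.List using (List; []; _∷_; map; filter; _++_; length; allFin)
open import Data.List.Membership.Propositional using (_∈_)
open import Data.List.Membership.Propositional.Properties using (∈-filter⁺; ∈-filter⁻; ∈-allFin)
open import Data.List.Properties
  using (map-++; map-cong; map-∘; map-tabulate; length-tabulate; foldr-preservesᵇ; foldr-preservesʳ)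
import Data.List.Relation.Unary.All as All
open import Data.List.Relation.Unary.All.Properties using (map⁺)
open import Data.List.Relation.Unary.Any using (here; there)
open import Data.Maybe using (Maybe; just; nothing; is-nothing)
open import Data.Nat using (ℕ; zero; suc; _+_; _*_; _∸_; _^_; _≤_; _<_; z≤n; z<s)
open import Data.Nat.ListAction using (sum)
open import Data.Nat.ListAction.Properties using (sum-++)
open import Data.Nat.Properties hiding (_≟_)
open import Algebra.Properties.CommutativeSemigroup +-commutativeSemigroup using (interchange)
open import Data.Product using (∃; _×_; _,_; proj₂)
open import Data.Vec using ([]; _∷_; lookup)
open import Function using (_∘_; id)
open import Level using (Level)
open import Relation.Binary.PropositionalEquality
open import Relation.Nullary using (yes; no; does)
open import Relation.Nullary.Decidable using (dec-true)
open import Relation.Unary using (Pred; Decidable)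

open import Defs

private
  variable
    a b : Level
    A : Set a
    B : Set b

∑ : List A → (A → ℕ) → ℕ
∑ xs h = sum (map h xs)

⟦_⟧ : Bool → ℕ
⟦ true ⟧  = 1
⟦ false ⟧ = 0

∑-cong : ∀ (xs : List A) {g h : A → ℕ} → (∀ x → g x ≡ h x) → ∑ xs g ≡ ∑ xs h
∑-cong xs g≗h = cong sum (map-cong g≗h xs)

∑-mono : ∀ (xs : List A) {g h : A → ℕ} → (∀ x → g x ≤ h x) → ∑ xs g ≤ ∑ xs h
∑-mono []       g≤h = z≤n
∑-mono (x ∷ xs) g≤h = +-mono-≤ (g≤h x) (∑-mono xs g≤h)

∑-zero : ∀ (xs : List A) → ∑ xs (λ _ → 0) ≡ 0
∑-zero []       = refl
∑-zero (x ∷ xs) = ∑-zero xs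

∑-const : ∀ (xs : List A) k → ∑ xs (λ _ → k) ≡ length xs * k
∑-const []       k = refl
∑-const (x ∷ xs) k = cong (k +_) (∑-const xs k)

∑-distrib-+ : ∀ (xs : List A) g h → ∑ xs (λ x → g x + h x) ≡ ∑ xs g + ∑ xs h
∑-distrib-+ []       g h = refl
∑-distrib-+ (x ∷ xs) g h = begin
  g x + h x + ∑ xs (λ x → g x + h x) ≡⟨ cong (g x + h x +_) (∑-distrib-+ xs g h) ⟩
  g x + h x + (∑ xs g + ∑ xs h)      ≡⟨ interchange (g x) (h x) (∑ xs g) (∑ xs h) ⟩
  g x + ∑ xs g + (h x + ∑ xs h)      ∎
  where open ≡-Reasoning

∑-*ˡ : ∀ (xs : List A) k h → ∑ xs (λ x → k * h x) ≡ k * ∑ xs h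
∑-*ˡ []       k h = sym (*-zeroʳ k)
∑-*ˡ (x ∷ xs) k h = trans (cong (k * h x +_) (∑-*ˡ xs k h)) (sym (*-distribˡ-+ k (h x) _))

∑-++ : ∀ (xs ys : List A) h → ∑ (xs ++ ys) h ≡ ∑ xs h + ∑ ys h
∑-++ xs ys h = trans (cong sum (map-++ h xs ys)) (sum-++ (map h xs) (map h ys))

∑-map : ∀ (f : B → A) (xs : List B) h → ∑ (map f xs) h ≡ ∑ xs (h ∘ f)
∑-map f xs h = cong sum (sym (map-∘ xs))

∑-comm : (xs : List A) (ys : List B) (h : A → B → ℕ) →
         ∑ xs (λ x → ∑ ys (h x)) ≡ ∑ ys (λ y → ∑ xs (λ x → h x y))
∑-comm []       ys h = sym (∑-zero ys)
∑-comm (x ∷ xs) ys h =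
  trans (cong (∑ ys (h x) +_) (∑-comm xs ys h)) (sym (∑-distrib-+ ys (h x) _))

∑-∈ : ∀ {xs : List A} (h : A → ℕ) {x} → x ∈ xs → h x ≤ ∑ xs h
∑-∈ h (here refl)  = m≤m+n (h _) _
∑-∈ h (there x∈xs) = ≤-trans (∑-∈ h x∈xs) (m≤n+m _ (h _))

∑-bound : ∀ (xs : List A) (h : A → ℕ) {m} →
          (∀ {x} → x ∈ xs → 0 < h x → ∑ xs h ≤ m) → ∑ xs h ≤ m
∑-bound []       h bound = z≤n
∑-bound (x ∷ xs) h bound with h x in hx
... | zero  = ∑-bound xs h (λ y∈xs → bound (there y∈xs))
... | suc _ = bound (here refl) (subst (0 <_) (sym hx) z<s)

∑-filter : ∀ {p} {P : Pred A p} (P? : Decidable P) (xs : List A) h →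
           ∑ (filter P? xs) h ≡ ∑ xs (λ x → if does (P? x) then h x else 0)
∑-filter P? []       h = refl
∑-filter P? (x ∷ xs) h with does (P? x)
... | true  = cong (h x +_) (∑-filter P? xs h)
... | false = ∑-filter P? xs h

length-filter : ∀ {p} {P : Pred A p} (P? : Decidable P) (xs : List A) →
                length (filter P? xs) ≡ ∑ xs (λ x → ⟦ does (P? x) ⟧)
length-filter P? []       = refl
length-filter P? (x ∷ xs) with does (P? x)
... | true  = cong suc (length-filter P? xs)
... | false = length-filter P? xs

and-map⁺ : ∀ (xs : List A) {g : A → Bool} → (∀ {x} → x ∈ xs → g x ≡ true) → and (map g xs) ≡ true
and-map⁺ []       all = refl
and-map⁺ (x ∷ xs) all = cong₂ _∧_ (all (here refl)) (and-map⁺ xs (all ∘ there))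

and-map⁻ : ∀ (xs : List A) {g : A → Bool} → and (map g xs) ≡ true → ∀ {x} → x ∈ xs → g x ≡ true
and-map⁻ (x ∷ xs) all (here refl)  = ∧-conicalˡ _ _ all
and-map⁻ (x ∷ xs) all (there x∈xs) = and-map⁻ xs (∧-conicalʳ _ _ all) x∈xs

∑-allFin-suc : ∀ n (h : Fin (suc n) → ℕ) → ∑ (allFin (suc n)) h ≡ h zero + ∑ (allFin n) (h ∘ suc)
∑-allFin-suc n h =
  cong (h zero +_) (cong sum (trans (map-tabulate suc h) (sym (map-tabulate id (h ∘ suc)))))

∑-allFin-const : ∀ n k → ∑ (allFin n) (λ _ → k) ≡ n * k
∑-allFin-const n k = trans (∑-const (allFin n) k) (cong (_* k) (length-tabulate {n = n} id))

∑-allFin-≟ : ∀ {n} (x : Fin n) → ∑ (allFin n) (λ y → ⟦ does (x ≟ y) ⟧) ≡ 1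
∑-allFin-≟ {suc n} zero    =
  trans (∑-allFin-suc n (λ y → ⟦ does (zero ≟ y) ⟧)) (cong suc (∑-zero (allFin n)))
∑-allFin-≟ {suc n} (suc x) = trans (∑-allFin-suc n (λ y → ⟦ does (suc x ≟ y) ⟧)) (∑-allFin-≟ x)

does-≟-true : ∀ b → does (b Bool.≟ true) ≡ b
does-≟-true true  = refl
does-≟-true false = refl

-- Counting subsets with prescribed members

-- just b forces the membership of a position to be b; nothing leaves it free.
Pattern : ℕ → Set
Pattern n = Fin n → Maybe Bool

fits : Maybe Bool → Bool → Bool
fits nothing      b = true
fits (just true)  b = b
fits (just false) b = not b

matches : ∀ {n} → Pattern n → Subset n → Bool
matches {zero}  p []      = true
matches {suc n} p (b ∷ I) = fits (p zero) b ∧ matches (p ∘ suc) I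

free : ∀ {n} → Pattern n → ℕ
free {n} p = ∑ (allFin n) (λ y → ⟦ is-nothing (p y) ⟧)

matches⁺ : ∀ {n} (p : Pattern n) I → (∀ y → fits (p y) (lookup I y) ≡ true) → matches p I ≡ true
matches⁺ {n = zero}  p []      fit = refl
matches⁺ {n = suc n} p (b ∷ I) fit = cong₂ _∧_ (fit zero) (matches⁺ (p ∘ suc) I (fit ∘ suc))

matches⁻ : ∀ {n} (p : Pattern n) I → matches p I ≡ true → ∀ y → fits (p y) (lookup I y) ≡ true
matches⁻ {n = suc n} p (b ∷ I) m zero    = ∧-conicalˡ _ _ m
matches⁻ {n = suc n} p (b ∷ I) m (suc y) = matches⁻ (p ∘ suc) I (∧-conicalʳ _ _ m) y

∑-subsets-suc : ∀ n (h : Subset (suc n) → ℕ) →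
                ∑ (subsets (suc n)) h ≡ ∑ (subsets n) (h ∘ (false ∷_)) + ∑ (subsets n) (h ∘ (true ∷_))
∑-subsets-suc n h = trans (∑-++ (map (false ∷_) (subsets n)) _ h)
                          (cong₂ _+_ (∑-map _ (subsets n) h) (∑-map _ (subsets n) h))

∑-matches : ∀ {n} (p : Pattern n) → ∑ (subsets n) (⟦_⟧ ∘ matches p) ≡ 2 ^ free p
∑-matches {zero}  p = refl
∑-matches {suc n} p =
  trans (∑-subsets-suc n (⟦_⟧ ∘ matches p))
        (trans (split (p zero)) (cong (2 ^_) (sym (∑-allFin-suc n (λ y → ⟦ is-nothing (p y) ⟧)))))
  where
  count = ∑-matches (p ∘ suc)
  split : ∀ c → ∑ (subsets n) (λ I → ⟦ fits c false ∧ matches (p ∘ suc) I ⟧)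
              + ∑ (subsets n) (λ I → ⟦ fits c true ∧ matches (p ∘ suc) I ⟧)
              ≡ 2 ^ (⟦ is-nothing c ⟧ + free (p ∘ suc))
  split nothing      = cong₂ _+_ count (trans count (sym (+-identityʳ _)))
  split (just true)  = cong₂ _+_ (∑-zero (subsets n)) count
  split (just false) = trans (cong₂ _+_ count (∑-zero (subsets n))) (+-identityʳ _)

module _ {s : ℕ} where

  ∈-members⁺ : ∀ (I : Subset s) {x} → lookup I x ≡ true → x ∈ members I
  ∈-members⁺ I {x} Ix = ∈-filter⁺ (λ y → lookup I y Bool.≟ true) (∈-allFin x) Ix

  ∈-members⁻ : ∀ (I : Subset s) {x} → x ∈ members I → lookup I x ≡ true
  ∈-members⁻ I x∈I = proj₂ (∈-filter⁻ (λ y → lookup I y Bool.≟ true) {xs = allFin s} x∈I)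

  independent⁺ : ∀ (R : Graph s) I →
                 (∀ {x y} → x ∈ members I → y ∈ members I → adj R x y ≡ false) →
                 independent R I ≡ true
  independent⁺ R I nonadj =
    and-map⁺ (members I) λ x∈I → and-map⁺ (members I) λ y∈I → cong not (nonadj x∈I y∈I)

  independent⁻ : ∀ (R : Graph s) I → independent R I ≡ true →
                 ∀ {x y} → x ∈ members I → y ∈ members I → adj R x y ≡ false
  independent⁻ R I ind x∈I y∈I =
    not-injective (and-map⁻ (members I) (and-map⁻ (members I) ind x∈I) y∈I)

  nonempty⁺ : ∀ (I : Subset s) {x} → x ∈ members I → nonempty I ≡ true
  nonempty⁺ I x∈I with members I
  ... | _ ∷ _ = refl

  δ-witness : ∀ (R : Graph s) I → nonempty I ≡ true → ∃ λ x → x ∈ members I × δ R I ≤ degree R x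
  δ-witness R I ne with members I
  ... | x ∷ xs =
    x , here refl , foldr-preservesʳ {P = _≤ degree R x} (λ d → ≤-trans (m⊓n≤n d _)) ≤-refl (map (degree R) xs)

  δ-glb : ∀ (R : Graph s) I {k} → nonempty I ≡ true →
          (∀ {x} → x ∈ members I → k ≤ degree R x) → k ≤ δ R I
  δ-glb R I {k} ne k≤ with members I
  ... | x ∷ xs = foldr-preservesᵇ {P = k ≤_} ⊓-glb (k≤ (here refl)) (map⁺ (All.tabulate (k≤ ∘ there)))

-- The family of a vertex

module _ {s : ℕ} (R : Graph s) where

  -- Matched exactly by the sets that contain x and no neighbour of x.
  isolating : Fin s → Pattern s
  isolating x y = if does (x ≟ y) then just true else if adj R x y then just false else nothing

  weight : Fin s → ℕ
  weight x = 2 ^ degree R x ∸ 1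

  degree≡∑ : ∀ x → degree R x ≡ ∑ (allFin s) (λ y → ⟦ adj R x y ⟧)
  degree≡∑ x = trans (length-filter (λ y → adj R x y Bool.≟ true) (allFin s))
                     (∑-cong (allFin s) (λ y → cong ⟦_⟧ (does-≟-true (adj R x y))))

  isolating-partition : ∀ x y → ⟦ is-nothing (isolating x y) ⟧ + ⟦ adj R x y ⟧ + ⟦ does (x ≟ y) ⟧ ≡ 1
  isolating-partition x y with x ≟ y
  ... | yes refl rewrite irrefl R x = refl
  ... | no _ with adj R x y
  ...   | true  = refl
  ...   | false = refl

  free+degree+1≡s : ∀ x → free (isolating x) + degree R x + 1 ≡ s
  free+degree+1≡s x = begin
    free (isolating x) + degree R x + 1
      ≡⟨ cong₂ (λ d e → free (isolating x) + d + e) (degree≡∑ x) (sym (∑-allFin-≟ x)) ⟩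
    ∑ (allFin s) F + ∑ (allFin s) D + ∑ (allFin s) E
      ≡⟨ cong (_+ ∑ (allFin s) E) (sym (∑-distrib-+ (allFin s) F D)) ⟩
    ∑ (allFin s) (λ y → F y + D y) + ∑ (allFin s) E
      ≡⟨ sym (∑-distrib-+ (allFin s) _ E) ⟩
    ∑ (allFin s) (λ y → F y + D y + E y)
      ≡⟨ ∑-cong (allFin s) (isolating-partition x) ⟩
    ∑ (allFin s) (λ _ → 1)
      ≡⟨ trans (∑-allFin-const s 1) (*-identityʳ s) ⟩
    s ∎
    where
    open ≡-Reasoning
    F D E : Fin s → ℕ
    F y = ⟦ is-nothing (isolating x y) ⟧
    D y = ⟦ adj R x y ⟧
    E y = ⟦ does (x ≟ y) ⟧

  isolating⇒∈ : ∀ x I → matches (isolating x) I ≡ true → lookup I x ≡ true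
  isolating⇒∈ x I m with x ≟ x | matches⁻ (isolating x) I m x
  ... | yes _  | Ix = Ix
  ... | no x≢x | _  = ⊥-elim (x≢x refl)

  independent⇒isolating : ∀ {x} I → independent R I ≡ true → x ∈ members I →
                          matches (isolating x) I ≡ true
  independent⇒isolating {x} I ind x∈I = matches⁺ (isolating x) I fit
    where
    fit : ∀ y → fits (isolating x y) (lookup I y) ≡ true
    fit y with x ≟ y
    ... | yes refl = ∈-members⁻ I x∈I
    ... | no _ with adj R x y in xy | lookup I y in Iy
    ...   | false | _     = refl
    ...   | true  | false = refl
    ...   | true  | true  with () ← trans (sym xy) (independent⁻ R I ind x∈I (∈-members⁺ I Iy))

  loss : Subset s → ℕ
  loss I = if independent R I ∧ nonempty I then 2 ^ δ R I ∸ 1 else 0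

  loss-independent : ∀ I → independent R I ≡ true → nonempty I ≡ true → loss I ≡ 2 ^ δ R I ∸ 1
  loss-independent I ind ne rewrite ind | ne = refl

  φ≡∑-loss : φ R ≡ ∑ (subsets s) loss
  φ≡∑-loss = trans (∑-filter (λ I → (independent R I ∧ nonempty I) Bool.≟ true) (subsets s) _)
                   (∑-cong (subsets s) λ I →
                     cong (λ b → if b then 2 ^ δ R I ∸ 1 else 0) (does-≟-true (independent R I ∧ nonempty I)))

  cover : Subset s → ℕ
  cover I = ∑ (allFin s) (λ x → weight x * ⟦ matches (isolating x) I ⟧)

  loss≤cover : ∀ I → loss I ≤ cover I
  loss≤cover I with independent R I in ind | nonempty I in ne
  ... | false | _     = z≤n
  ... | true  | false = z≤n
  ... | true  | true with δ-witness R I ne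
  ...   | x , x∈I , δ≤dx = begin
    2 ^ δ R I ∸ 1                              ≤⟨ ∸-monoˡ-≤ 1 (^-monoʳ-≤ 2 δ≤dx) ⟩
    weight x                                   ≡⟨ sym (*-identityʳ (weight x)) ⟩
    weight x * ⟦ true ⟧
      ≡⟨ cong (λ b → weight x * ⟦ b ⟧) (sym (independent⇒isolating I ind x∈I)) ⟩
    weight x * ⟦ matches (isolating x) I ⟧
      ≤⟨ ∑-∈ (λ x → weight x * ⟦ matches (isolating x) I ⟧) (∈-allFin x) ⟩
    cover I                                    ∎
    where open ≤-Reasoning

  ∑-cover : ∑ (subsets s) cover ≡ ∑ (allFin s) (λ x → weight x * 2 ^ free (isolating x))
  ∑-cover = trans (∑-comm (subsets s) (allFin s) (λ I x → weight x * ⟦ matches (isolating x) I ⟧))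
                  (∑-cong (allFin s) λ x →
                    trans (∑-*ˡ (subsets s) (weight x) (⟦_⟧ ∘ matches (isolating x)))
                          (cong (weight x *_) (∑-matches (isolating x))))

  free+degree≡s∸1 : ∀ x → free (isolating x) + degree R x ≡ s ∸ 1
  free+degree≡s∸1 x = trans (sym (m+n∸n≡m _ 1)) (cong (_∸ 1) (free+degree+1≡s x))

  weight*2^free≤ : ∀ x → weight x * 2 ^ free (isolating x) ≤ 2 ^ (s ∸ 1) ∸ 1
  weight*2^free≤ x = begin
    (2 ^ d ∸ 1) * 2 ^ f       ≡⟨ *-distribʳ-∸ (2 ^ f) (2 ^ d) 1 ⟩
    2 ^ d * 2 ^ f ∸ 1 * 2 ^ f ≡⟨ cong₂ _∸_ (trans (*-comm (2 ^ d) (2 ^ f)) (sym (^-distribˡ-+-* 2 f d)))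
                                           (*-identityˡ (2 ^ f)) ⟩
    2 ^ (f + d) ∸ 2 ^ f       ≤⟨ ∸-monoʳ-≤ (2 ^ (f + d)) (m^n>0 2 f) ⟩
    2 ^ (f + d) ∸ 1           ≡⟨ cong (λ e → 2 ^ e ∸ 1) (free+degree≡s∸1 x) ⟩
    2 ^ (s ∸ 1) ∸ 1           ∎
    where
    open ≤-Reasoning
    d = degree R x
    f = free (isolating x)

  φ≤s*[2^[s∸1]∸1] : φ R ≤ s * (2 ^ (s ∸ 1) ∸ 1)
  φ≤s*[2^[s∸1]∸1] = begin
    φ R                                                    ≡⟨ φ≡∑-loss ⟩
    ∑ (subsets s) loss                                     ≤⟨ ∑-mono (subsets s) loss≤cover ⟩
    ∑ (subsets s) cover                                    ≡⟨ ∑-cover ⟩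
    ∑ (allFin s) (λ x → weight x * 2 ^ free (isolating x)) ≤⟨ ∑-mono (allFin s) weight*2^free≤ ⟩
    ∑ (allFin s) (λ _ → 2 ^ (s ∸ 1) ∸ 1)                   ≡⟨ ∑-allFin-const s _ ⟩
    s * (2 ^ (s ∸ 1) ∸ 1)                                  ∎
    where open ≤-Reasoning

-- The complete graph

0<k*⟦b⟧⇒b≡true : ∀ k b → 0 < k * ⟦ b ⟧ → b ≡ true
0<k*⟦b⟧⇒b≡true k true  _   = refl
0<k*⟦b⟧⇒b≡true k false pos = ⊥-elim (<-irrefl refl (subst (0 <_) (*-zeroʳ k) pos))

module _ {s : ℕ} where

  free-isolating-K : ∀ x → free (isolating (K s) x) ≡ 0
  free-isolating-K x = trans (∑-cong (allFin s) forced) (∑-zero (allFin s))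
    where
    forced : ∀ y → ⟦ is-nothing (isolating (K s) x y) ⟧ ≡ 0
    forced y with x ≟ y
    ... | yes _ = refl
    ... | no _  = refl

  degree-K : ∀ x → degree (K s) x ≡ s ∸ 1
  degree-K x = trans (cong (_+ degree (K s) x) (sym (free-isolating-K x))) (free+degree≡s∸1 (K s) x)

  isolating-K⇒≡ : ∀ x I → matches (isolating (K s) x) I ≡ true → ∀ {y} → lookup I y ≡ true → y ≡ x
  isolating-K⇒≡ x I m {y} Iy with x ≟ y | matches⁻ (isolating (K s) x) I m y
  ... | yes x≡y | _   = sym x≡y
  ... | no _    | fit with () ← trans (cong not (sym Iy)) fit

  isolating-K⇒loss : ∀ x I → matches (isolating (K s) x) I ≡ true → 2 ^ (s ∸ 1) ∸ 1 ≤ loss (K s) I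
  isolating-K⇒loss x I m = begin
    2 ^ (s ∸ 1) ∸ 1   ≤⟨ ∸-monoˡ-≤ 1 (^-monoʳ-≤ 2 (δ-glb (K s) I I≢∅ λ {y} _ → ≤-reflexive (sym (degree-K y))))
                       ⟩
    2 ^ δ (K s) I ∸ 1 ≡⟨ sym (loss-independent (K s) I (independent⁺ (K s) I nonadjacent) I≢∅) ⟩
    loss (K s) I      ∎
    where
    open ≤-Reasoning
    x∈I : x ∈ members I
    x∈I = ∈-members⁺ I (isolating⇒∈ (K s) x I m)
    I≢∅ : nonempty I ≡ true
    I≢∅ = nonempty⁺ I x∈I
    nonadjacent : ∀ {y z} → y ∈ members I → z ∈ members I → adj (K s) y z ≡ false
    nonadjacent y∈I z∈I = subst₂ (λ y z → adj (K s) y z ≡ false)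
      (sym (isolating-K⇒≡ x I m (∈-members⁻ I y∈I)))
      (sym (isolating-K⇒≡ x I m (∈-members⁻ I z∈I)))
      (irrefl (K s) x)

  cover≤loss-K : ∀ I → cover (K s) I ≤ loss (K s) I
  cover≤loss-K I = ∑-bound (allFin s) _ λ {x} _ pos →
    let mx = 0<k*⟦b⟧⇒b≡true (weight (K s) x) _ pos in begin
    cover (K s) I                             ≤⟨ ∑-mono (allFin s) (at-most x mx) ⟩
    ∑ (allFin s) (λ y → W * ⟦ does (x ≟ y) ⟧) ≡⟨ ∑-*ˡ (allFin s) W _ ⟩
    W * ∑ (allFin s) (λ y → ⟦ does (x ≟ y) ⟧) ≡⟨ cong (W *_) (∑-allFin-≟ x) ⟩
    W * 1                                     ≡⟨ *-identityʳ W ⟩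
    W                                         ≤⟨ isolating-K⇒loss x I mx ⟩
    loss (K s) I                              ∎
    where
    open ≤-Reasoning
    W = 2 ^ (s ∸ 1) ∸ 1
    at-most : ∀ x → matches (isolating (K s) x) I ≡ true →
              ∀ y → weight (K s) y * ⟦ matches (isolating (K s) y) I ⟧ ≤ W * ⟦ does (x ≟ y) ⟧
    at-most x mx y =
      ≤-trans (≤-reflexive (cong (λ d → (2 ^ d ∸ 1) * ⟦ matches (isolating (K s) y) I ⟧) (degree-K y)))
              (*-monoʳ-≤ W bracket)
      where
      bracket : ⟦ matches (isolating (K s) y) I ⟧ ≤ ⟦ does (x ≟ y) ⟧
      bracket with matches (isolating (K s) y) I in my
      ... | false = z≤n
      ... | true  = subst (λ z → 1 ≤ ⟦ does (x ≟ z) ⟧)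
                          (sym (isolating-K⇒≡ x I mx (isolating⇒∈ (K s) y I my)))
                          (≤-reflexive (cong ⟦_⟧ (sym (dec-true (x ≟ x) refl))))

  φ-K : φ (K s) ≡ s * (2 ^ (s ∸ 1) ∸ 1)
  φ-K = begin
    φ (K s)                       ≡⟨ φ≡∑-loss (K s) ⟩
    ∑ (subsets s) (loss (K s))
      ≡⟨ ∑-cong (subsets s) (λ I → ≤-antisym (loss≤cover (K s) I) (cover≤loss-K I)) ⟩
    ∑ (subsets s) (cover (K s))   ≡⟨ ∑-cover (K s) ⟩
    ∑ (allFin s) (λ x → weight (K s) x * 2 ^ free (isolating (K s) x))
      ≡⟨ ∑-cong (allFin s) (λ x →
           cong₂ (λ d f → (2 ^ d ∸ 1) * 2 ^ f) (degree-K x) (free-isolating-K x)) ⟩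
    ∑ (allFin s) (λ _ → W * 1)    ≡⟨ ∑-allFin-const s (W * 1) ⟩
    s * (W * 1)                   ≡⟨ cong (s *_) (*-identityʳ W) ⟩
    s * W                         ∎
    where
    open ≡-Reasoning
    W = 2 ^ (s ∸ 1) ∸ 1

theorem4p6 : (s : ℕ) (R : Graph s) → (φ R ≤ φ (K s)) × (φ (K s) ≡ s * (2 ^ (s ∸ 1) ∸ 1))
theorem4p6 s R = subst (φ R ≤_) (sym (φ-K {s})) (φ≤s*[2^[s∸1]∸1] R) , φ-K {s}
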